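{- Let $M\in\mathbb{R}^{n\times d}$. The permanent structure $\mathcal{P}(M)$ is a downward-closed subset of $\mathbb{B}^{n\times d}$: if $\sigma\in\mathcal{P}(M)$ and $\tau\in\mathbb{B}^{n\times d}$ with $\tau\preceq\sigma$, then $\tau\in\mathcal{P}(M)$.
   Context: $\mathbb{B}^{n\times d}$ is the set of $n\times d$ Boolean matrices, ordered entrywise ($A\preceq B$ iff $A_{ij}\le B_{ij}$ for all $i,j$). A partial bijection $\sigma:[d]\dashrightarrow[n]$ is a bijection $\sigma:J\to I$ with $J\subseteq[d]$, $I\subseteq[n]$, identified with the matrix $\Sigma\in\mathbb{B}^{n\times d}$ with $\Sigma_{ij}=1$ iff $j\in J$ and $i=\sigma(j)$ (so partial bijections are exactly the Boolean matrices with at most one $1$ in each row and each column). $\sigma$ is permanent-attaining with respect to $M$ if $\sum_{j\in J}M_{\sigma(j),j}\ge\sum_{j\in J}M_{\tau(j),j}$ for every bijection $\tau:J\to I$. $\mathcal{P}(M)\subseteq\mathbb{B}^{n\times d}$ is the set of all partial bijections that are permanent-attaining with respect to $M$. -}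

module Defs where

open import Level using (Level; _⊔_) renaming (suc to lsuc)
open import Data.Nat using (ℕ; zero) renaming (suc to sucℕ)
open import Data.Fin using (Fin; zero; suc)
open import Data.Bool using (Bool; true; false; if_then_else_; _∨_)
open import Data.Sum using (_⊎_)
open import Data.Product using (Σ; ∃; _×_; _,_)
open import Relation.Binary.PropositionalEquality using (_≡_)

-- The statement only uses
-- the additive, totally ordered structure of ℝ, so we state it for an
-- arbitrary totally ordered abelian group (ℝ being an instance).
record OrderedAbelianGroup (c ℓ : Level) : Set (lsuc (c ⊔ ℓ)) where
  infixl 6 _+_
  infix 4 _≤_
  field
    Carrier   : Set c
    _+_       : Carrier → Carrier → Carrier
    0#        : Carrier
    -_        : Carrier → Carrier
    _≤_       : Carrier → Carrier → Set ℓ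
    +-assoc   : ∀ x y z → (x + y) + z ≡ x + (y + z)
    +-comm    : ∀ x y → x + y ≡ y + x
    +-identityˡ : ∀ x → 0# + x ≡ x
    -‿inverseˡ : ∀ x → (- x) + x ≡ 0#
    ≤-refl    : ∀ x → x ≤ x
    ≤-trans   : ∀ {x y z} → x ≤ y → y ≤ z → x ≤ z
    ≤-antisym : ∀ {x y} → x ≤ y → y ≤ x → x ≡ y
    ≤-total   : ∀ x y → (x ≤ y) ⊎ (y ≤ x)
    +-monoˡ-≤ : ∀ {x y} z → x ≤ y → x + z ≤ y + z

BMat : ℕ → ℕ → Set
BMat n d = Fin n → Fin d → Bool

_⪯_ : ∀ {n d} → BMat n d → BMat n d → Set
A ⪯ B = ∀ i j → A i j ≡ true → B i j ≡ true

anyFin : ∀ {n} → (Fin n → Bool) → Bool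
anyFin {zero}   f = false
anyFin {sucℕ n} f = f zero ∨ anyFin (λ i → f (suc i))

inJ : ∀ {n d} → BMat n d → Fin d → Bool
inJ S j = anyFin (λ i → S i j)

inI : ∀ {n d} → BMat n d → Fin n → Bool
inI S i = anyFin (λ j → S i j)

IsPartialBijection : ∀ {n d} → BMat n d → Set
IsPartialBijection S =
  (∀ i j j′ → S i j ≡ true → S i j′ ≡ true → j ≡ j′) ×
  (∀ i i′ j → S i j ≡ true → S i′ j ≡ true → i ≡ i′)

module _ {c ℓ} (R : OrderedAbelianGroup c ℓ) where
  open OrderedAbelianGroup R

  sumFin : ∀ {n} → (Fin n → Carrier) → Carrier
  sumFin {zero}   f = 0#
  sumFin {sucℕ n} f = f zero + sumFin (λ i → f (suc i))

  -- A map τ : Fin d → Fin n whose restriction to the column support J of S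
  -- is a bijection J → I onto the row support I of S (values outside J are
  -- irrelevant).
  IsBijectionOnto : ∀ {n d} → BMat n d → (Fin d → Fin n) → Set
  IsBijectionOnto S τ =
    (∀ j → inJ S j ≡ true → inI S (τ j) ≡ true) ×
    (∀ j j′ → inJ S j ≡ true → inJ S j′ ≡ true → τ j ≡ τ j′ → j ≡ j′) ×
    (∀ i → inI S i ≡ true → Σ (Fin _) λ j → (inJ S j ≡ true) × (τ j ≡ i))

  -- Σ_{j ∈ J} M_{σ(j), j} for the partial bijection σ given by S.
  weight : ∀ {n d} → (Fin n → Fin d → Carrier) → BMat n d → Carrier
  weight M S = sumFin (λ i → sumFin (λ j → if S i j then M i j else 0#))

  weightVia : ∀ {n d} → (Fin n → Fin d → Carrier) → BMat n d → (Fin d → Fin n) → Carrier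
  weightVia M S τ = sumFin (λ j → if inJ S j then M (τ j) j else 0#)

  InPerm : ∀ {n d} → (Fin n → Fin d → Carrier) → BMat n d → Set ℓ
  InPerm M S = IsPartialBijection S ×
    (∀ τ → IsBijectionOnto S τ → weightVia M S τ ≤ weight M S)

-- Given a bijection τ′ between the column and row supports of τ, extend it to the supports
-- of σ by following σ on the columns that τ misses; since σ is a partial bijection and
-- τ ⪯ σ, this is again a bijection. Along the extension σ collects the weight of τ′ plus
-- the weight of σ on the columns τ misses, while σ itself collects the weight of τ plus
-- that same surplus. So the optimality of σ against its extension cancels to the
-- optimality of τ against τ′.
module Submission where

open import Defs
open import Data.Nat using (ℕ)
open import Data.Fin using (Fin; zero; suc)
open import Data.Fin.Properties using (any?; suc-injective)
open import Data.Bool using (Bool; true; false; if_then_else_; _∧_; not)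
open import Data.Bool.Properties using (_≟_; not-¬)
open import Data.Product using (Σ; ∃; _×_; _,_; proj₁; proj₂)
open import Data.Empty using (⊥-elim)
open import Function using (_∘_)
open import Relation.Nullary using (yes; no)
open import Relation.Binary.PropositionalEquality
open import Relation.Binary.PropositionalEquality.Algebra using (isMagma)
open import Algebra.Bundles using (CommutativeMonoid)
open import Algebra.Structures.Biased using (isCommutativeMonoidˡ)
import Algebra.Properties.CommutativeMonoid.Sum as Sum

anyFin-intro : ∀ {n} (f : Fin n → Bool) i → f i ≡ true → anyFin f ≡ true
anyFin-intro f zero    fi≡true rewrite fi≡true = refl
anyFin-intro f (suc i) fi≡true with f zero
... | true  = refl
... | false = anyFin-intro (λ k → f (suc k)) i fi≡true

anyFin-witness : ∀ {n} (f : Fin n → Bool) → anyFin f ≡ true → ∃ λ i → f i ≡ true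
anyFin-witness {ℕ.suc n} f any≡true with f zero in f0
... | true  = zero , f0
... | false with anyFin-witness (λ k → f (suc k)) any≡true
...   | i , fi = suc i , fi

anyFin-mono : ∀ {n} {f g : Fin n → Bool} → (∀ i → f i ≡ true → g i ≡ true) →
              anyFin f ≡ true → anyFin g ≡ true
anyFin-mono {f = f} {g} f⇒g any-f =
  let i , fi = anyFin-witness f any-f in anyFin-intro g i (f⇒g i fi)

anyFin-false : ∀ {n} (f : Fin n → Bool) → anyFin f ≡ false → ∀ i → f i ≡ false
anyFin-false f any≡false i with f i in fi
... | false = refl
... | true  with () ← trans (sym (anyFin-intro f i fi)) any≡false

choose : ∀ {n} → (Fin n → Bool) → Fin n → Fin n
choose f i₀ with any? (λ i → f i ≟ true)
... | yes (i , _) = i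
... | no  _       = i₀

choose-true : ∀ {n} (f : Fin n → Bool) i₀ → anyFin f ≡ true → f (choose f i₀) ≡ true
choose-true f i₀ any≡true with any? (λ i → f i ≟ true)
... | yes (_ , fi) = fi
... | no  ¬∃       = ⊥-elim (¬∃ (anyFin-witness f any≡true))

RowsUnique ColumnsUnique : ∀ {n d} → BMat n d → Set
RowsUnique    S = ∀ i j j′ → S i j ≡ true → S i j′ ≡ true → j ≡ j′
ColumnsUnique S = ∀ i i′ j → S i j ≡ true → S i′ j ≡ true → i ≡ i′

Selects : ∀ {n d} → BMat n d → (Fin d → Fin n) → Set
Selects S κ = ∀ j → inJ S j ≡ true → S (κ j) j ≡ true

module _ {n d} {σ τ : BMat n d} (τ⪯σ : τ ⪯ σ) where

  ⪯-rowsUnique : RowsUnique σ → RowsUnique τ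
  ⪯-rowsUnique uσ i j j′ τij τij′ = uσ i j j′ (τ⪯σ i j τij) (τ⪯σ i j′ τij′)

  ⪯-columnsUnique : ColumnsUnique σ → ColumnsUnique τ
  ⪯-columnsUnique uσ i i′ j τij τi′j = uσ i i′ j (τ⪯σ i j τij) (τ⪯σ i′ j τi′j)

  ⪯-inJ : ∀ j → inJ τ j ≡ true → inJ σ j ≡ true
  ⪯-inJ j = anyFin-mono (λ i → τ⪯σ i j)

  ⪯-inI : ∀ i → inI τ i ≡ true → inI σ i ≡ true
  ⪯-inI i = anyFin-mono (τ⪯σ i)

  ⪯-sameRow : RowsUnique σ → ∀ {i j j′} → τ i j ≡ true → σ i j′ ≡ true → τ i j′ ≡ true
  ⪯-sameRow uσ τij σij′ = subst (λ k → τ _ k ≡ true) (uσ _ _ _ (τ⪯σ _ _ τij) σij′) τij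

  ⪯-sameColumn : ColumnsUnique σ → ∀ {i i′ j} → τ i j ≡ true → σ i′ j ≡ true → τ i′ j ≡ true
  ⪯-sameColumn uσ τij σi′j = subst (λ k → τ k _ ≡ true) (uσ _ _ _ (τ⪯σ _ _ τij) σi′j) τij

  ⪯-columnHit : ColumnsUnique σ → ∀ {i j} → inJ τ j ≡ true → σ i j ≡ true → τ i j ≡ true
  ⪯-columnHit uσ {j = j} inJτ σij =
    let _ , τi′j = anyFin-witness (λ k → τ k j) inJτ in ⪯-sameColumn uσ τi′j σij

  ⪯-selects : ColumnsUnique σ → ∀ {κ} → Selects σ κ → Selects τ κ
  ⪯-selects uσ sel j inJτ = ⪯-columnHit uσ inJτ (sel j (⪯-inJ j inJτ))

  ⪯-freeRow⇒freeColumn : ColumnsUnique σ → ∀ {i j} → inI τ i ≡ false → σ i j ≡ true → inJ τ j ≡ false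
  ⪯-freeRow⇒freeColumn uσ {i} {j} inIτ σij with inJ τ j in inJτ
  ... | false = refl
  ... | true  with () ← trans (sym (anyFin-intro (τ i) j (⪯-columnHit uσ inJτ σij))) inIτ

module Weights {c ℓ} (R : OrderedAbelianGroup c ℓ) where
  open OrderedAbelianGroup R

  +-commutativeMonoid : CommutativeMonoid c c
  +-commutativeMonoid = record
    { isCommutativeMonoid = isCommutativeMonoidˡ record
      { isSemigroup = record { isMagma = isMagma _+_ ; assoc = +-assoc }
      ; identityˡ   = +-identityˡ
      ; comm        = +-comm
      }
    }

  open Sum +-commutativeMonoid using (sum; ∑-comm; ∑-distrib-+; sum-cong-≗)

  +-identityʳ : ∀ x → x + 0# ≡ x
  +-identityʳ x = trans (+-comm x 0#) (+-identityˡ x)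

  +-cancelʳ-≤ : ∀ {x y} z → x + z ≤ y + z → x ≤ y
  +-cancelʳ-≤ {x} {y} z x+z≤y+z = subst₂ _≤_ (+z-z x) (+z-z y) (+-monoˡ-≤ (- z) x+z≤y+z)
    where
    +z-z : ∀ w → (w + z) + (- z) ≡ w
    +z-z w = begin
      (w + z) + (- z)  ≡⟨ +-assoc w z (- z) ⟩
      w + (z + (- z))  ≡⟨ cong (w +_) (+-comm z (- z)) ⟩
      w + ((- z) + z)  ≡⟨ cong (w +_) (-‿inverseˡ z) ⟩
      w + 0#           ≡⟨ +-identityʳ w ⟩
      w                ∎
      where open ≡-Reasoning

  sumFin≡sum : ∀ {n} (f : Fin n → Carrier) → sumFin R f ≡ sum f
  sumFin≡sum {ℕ.zero}  f = refl
  sumFin≡sum {ℕ.suc n} f = cong (f zero +_) (sumFin≡sum (λ i → f (suc i)))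

  masked : Bool → Carrier → Carrier
  masked b x = if b then x else 0#

  sumFin-masked-none : ∀ {n} (b : Fin n → Bool) (f : Fin n → Carrier) →
                       (∀ i → b i ≡ false) → sumFin R (λ i → masked (b i) (f i)) ≡ 0#
  sumFin-masked-none {ℕ.zero}  b f none = refl
  sumFin-masked-none {ℕ.suc n} b f none rewrite none zero =
    trans (+-identityˡ _) (sumFin-masked-none (λ i → b (suc i)) (λ i → f (suc i)) (none ∘ suc))

  sumFin-masked-single : ∀ {n} (b : Fin n → Bool) (f : Fin n → Carrier) {i₀} →
                         b i₀ ≡ true → (∀ i → b i ≡ true → i ≡ i₀) →
                         sumFin R (λ i → masked (b i) (f i)) ≡ f i₀
  sumFin-masked-single b f {zero} bi₀ only-i₀ rewrite bi₀ =
    trans (cong (f zero +_) (sumFin-masked-none (λ i → b (suc i)) (λ i → f (suc i)) not-suc))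
          (+-identityʳ (f zero))
    where
    not-suc : ∀ i → b (suc i) ≡ false
    not-suc i with b (suc i) in bi
    ... | false = refl
    ... | true  with () ← only-i₀ (suc i) bi
  sumFin-masked-single b f {suc i₀} bi₀ only-i₀ with b zero in b0
  ... | true  with () ← only-i₀ zero b0
  ... | false = trans (+-identityˡ _)
    (sumFin-masked-single (λ i → b (suc i)) (λ i → f (suc i)) bi₀ (λ i bi → suc-injective (only-i₀ (suc i) bi)))

  sumFin-cong : ∀ {n} {f g : Fin n → Carrier} → (∀ i → f i ≡ g i) → sumFin R f ≡ sumFin R g
  sumFin-cong {f = f} {g} f≗g = trans (sumFin≡sum f) (trans (sum-cong-≗ f≗g) (sym (sumFin≡sum g)))

  sumFin-+ : ∀ {n} (f g : Fin n → Carrier) →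
             sumFin R (λ i → f i + g i) ≡ sumFin R f + sumFin R g
  sumFin-+ f g = trans (sumFin≡sum (λ i → f i + g i))
    (trans (∑-distrib-+ f g) (sym (cong₂ _+_ (sumFin≡sum f) (sumFin≡sum g))))

  sumFin-comm : ∀ {m n} (f : Fin m → Fin n → Carrier) →
                sumFin R (λ i → sumFin R (f i)) ≡ sumFin R (λ j → sumFin R (λ i → f i j))
  sumFin-comm f = trans (sumFin²≡sum² f) (trans (∑-comm f) (sym (sumFin²≡sum² (λ j i → f i j))))
    where
    sumFin²≡sum² : ∀ {m n} (g : Fin m → Fin n → Carrier) →
                   sumFin R (λ i → sumFin R (g i)) ≡ sum (λ i → sum (g i))
    sumFin²≡sum² g = trans (sumFin≡sum (λ i → sumFin R (g i))) (sum-cong-≗ (λ i → sumFin≡sum (g i)))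

  masked-split : ∀ a b {x y z} → (a ≡ true → b ≡ true) → (a ≡ true → x ≡ y) → (a ≡ false → x ≡ z) →
                 masked b x ≡ masked a y + masked (b ∧ not a) z
  masked-split true  true  _   x≡y _   = trans (x≡y refl) (sym (+-identityʳ _))
  masked-split true  false a⇒b _   _   with () ← a⇒b refl
  masked-split false true  _   _   x≡z = trans (x≡z refl) (sym (+-identityˡ _))
  masked-split false false _   _   _   = sym (+-identityˡ 0#)

  module _ {n d} (M : Fin n → Fin d → Carrier) where

    columnWeight : ∀ {S κ} → ColumnsUnique S → Selects S κ → ∀ j →
                   sumFin R (λ i → masked (S i j) (M i j)) ≡ masked (inJ S j) (M (κ j) j)
    columnWeight {S} {κ} uS sel j with inJ S j in inJSj
    ... | true  = sumFin-masked-single (λ i → S i j) (λ i → M i j) (sel j inJSj)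
                    (λ i Sij → uS i (κ j) j Sij (sel j inJSj))
    ... | false = sumFin-masked-none (λ i → S i j) (λ i → M i j) (anyFin-false (λ i → S i j) inJSj)

    weight≡weightVia : ∀ {S κ} → ColumnsUnique S → Selects S κ → weight R M S ≡ weightVia R M S κ
    weight≡weightVia {S} uS sel =
      trans (sumFin-comm (λ i j → masked (S i j) (M i j))) (sumFin-cong (columnWeight uS sel))

    weightVia-split : ∀ {σ τ : BMat n d} {ρ ρ₁ κ : Fin d → Fin n} → τ ⪯ σ →
                      (∀ j → inJ τ j ≡ true → ρ j ≡ ρ₁ j) → (∀ j → inJ τ j ≡ false → ρ j ≡ κ j) →
                      weightVia R M σ ρ ≡
                      weightVia R M τ ρ₁ + sumFin R (λ j → masked (inJ σ j ∧ not (inJ τ j)) (M (κ j) j))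
    weightVia-split {σ} {τ} {ρ₁ = ρ₁} τ⪯σ on-τ off-τ =
      trans (sumFin-cong λ j → masked-split (inJ τ j) (inJ σ j) (⪯-inJ τ⪯σ j)
                                 (cong (λ i → M i j) ∘ on-τ j) (cong (λ i → M i j) ∘ off-τ j))
            (sumFin-+ (λ j → masked (inJ τ j) (M (ρ₁ j) j)) _)

module Extension {c ℓ} (R : OrderedAbelianGroup c ℓ) {n d}
  (M : Fin n → Fin d → OrderedAbelianGroup.Carrier R) {σ τ : BMat n d}
  (rowsσ : RowsUnique σ) (colsσ : ColumnsUnique σ) (τ⪯σ : τ ⪯ σ)
  {τ′ : Fin d → Fin n} (τ′-bij : IsBijectionOnto R τ τ′) where

  open OrderedAbelianGroup R using (Carrier; _+_)
  open Weights R

  τ′-into : ∀ j → inJ τ j ≡ true → inI τ (τ′ j) ≡ true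
  τ′-into = proj₁ τ′-bij

  τ′-injective : ∀ j j′ → inJ τ j ≡ true → inJ τ j′ ≡ true → τ′ j ≡ τ′ j′ → j ≡ j′
  τ′-injective = proj₁ (proj₂ τ′-bij)

  τ′-onto : ∀ i → inI τ i ≡ true → Σ (Fin d) λ j → (inJ τ j ≡ true) × (τ′ j ≡ i)
  τ′-onto = proj₂ (proj₂ τ′-bij)

  rowOf : Fin d → Fin n
  rowOf j = choose (λ i → σ i j) (τ′ j)

  rowOf-selects : Selects σ rowOf
  rowOf-selects j = choose-true (λ i → σ i j) (τ′ j)

  opaque
    extend : Fin d → Fin n
    extend j = if inJ τ j then τ′ j else rowOf j

    extend-on : ∀ j → inJ τ j ≡ true → extend j ≡ τ′ j
    extend-on j = cong (λ b → if b then τ′ j else rowOf j)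

    extend-off : ∀ j → inJ τ j ≡ false → extend j ≡ rowOf j
    extend-off j = cong (λ b → if b then τ′ j else rowOf j)

  extend-off-selects : ∀ {j} → inJ σ j ≡ true → inJ τ j ≡ false → σ (extend j) j ≡ true
  extend-off-selects {j} inJσ inJτ =
    subst (λ i → σ i j ≡ true) (sym (extend-off j inJτ)) (rowOf-selects j inJσ)

  extend-separates : ∀ {j j′} → inJ τ j ≡ true → inJ τ j′ ≡ false → inJ σ j′ ≡ true →
                     extend j ≢ extend j′
  extend-separates {j} {j′} inJτ inJτ′ inJσ′ eq =
    not-¬ (anyFin-intro (λ i → τ i j′) (τ′ j) τ-τ′j-j′) inJτ′
    where
    σ-τ′j-j′ : σ (τ′ j) j′ ≡ true
    σ-τ′j-j′ = subst (λ i → σ i j′ ≡ true) (trans (sym eq) (extend-on j inJτ))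
                 (extend-off-selects inJσ′ inJτ′)
    τ-τ′j-j′ : τ (τ′ j) j′ ≡ true
    τ-τ′j-j′ = let k , τ-τ′j-k = anyFin-witness (τ (τ′ j)) (τ′-into j inJτ)
               in ⪯-sameRow τ⪯σ rowsσ τ-τ′j-k σ-τ′j-j′

  extend-bijection : IsBijectionOnto R σ extend
  extend-bijection = into , injective , onto
    where

    into : ∀ j → inJ σ j ≡ true → inI σ (extend j) ≡ true
    into j inJσ with inJ τ j in inJτ
    ... | true  = subst (λ i → inI σ i ≡ true) (sym (extend-on j inJτ))
                    (⪯-inI τ⪯σ (τ′ j) (τ′-into j inJτ))
    ... | false = anyFin-intro (σ (extend j)) j (extend-off-selects inJσ inJτ)

    injective : ∀ j j′ → inJ σ j ≡ true → inJ σ j′ ≡ true → extend j ≡ extend j′ → j ≡ j′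
    injective j j′ inJσ inJσ′ eq with inJ τ j in inJτ | inJ τ j′ in inJτ′
    ... | true  | true  = τ′-injective j j′ inJτ inJτ′
                            (trans (sym (extend-on j inJτ)) (trans eq (extend-on j′ inJτ′)))
    ... | true  | false = ⊥-elim (extend-separates inJτ inJτ′ inJσ′ eq)
    ... | false | true  = ⊥-elim (extend-separates inJτ′ inJτ inJσ (sym eq))
    ... | false | false = rowsσ (extend j) j j′ (extend-off-selects inJσ inJτ)
                            (subst (λ i → σ i j′ ≡ true) (sym eq) (extend-off-selects inJσ′ inJτ′))

    onto : ∀ i → inI σ i ≡ true → Σ (Fin d) λ j → (inJ σ j ≡ true) × (extend j ≡ i)
    onto i inIσ with inI τ i in inIτ
    ... | true  = let j , inJτ , τ′j≡i = τ′-onto i inIτ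
                  in j , ⪯-inJ τ⪯σ j inJτ , trans (extend-on j inJτ) τ′j≡i
    ... | false = let j , σij = anyFin-witness (σ i) inIσ
                      inJσ = anyFin-intro (λ k → σ k j) i σij
                      inJτ = ⪯-freeRow⇒freeColumn τ⪯σ colsσ inIτ σij
                  in j , inJσ , colsσ (extend j) i j (extend-off-selects inJσ inJτ) σij

  surplus : Carrier
  surplus = sumFin R (λ j → masked (inJ σ j ∧ not (inJ τ j)) (M (rowOf j) j))

  weightVia-extend : weightVia R M σ extend ≡ weightVia R M τ τ′ + surplus
  weightVia-extend = weightVia-split M τ⪯σ extend-on extend-off

  weight≡weight+surplus : weight R M σ ≡ weight R M τ + surplus
  weight≡weight+surplus = begin
    weight R M σ                 ≡⟨ weight≡weightVia M colsσ rowOf-selects ⟩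
    weightVia R M σ rowOf        ≡⟨ weightVia-split M τ⪯σ (λ _ _ → refl) (λ _ _ → refl) ⟩
    weightVia R M τ rowOf + surplus
      ≡⟨ cong (_+ surplus) (sym (weight≡weightVia M (⪯-columnsUnique τ⪯σ colsσ)
                                   (⪯-selects τ⪯σ colsσ rowOf-selects))) ⟩
    weight R M τ + surplus       ∎
    where open ≡-Reasoning

proposition5p1 : ∀ {c ℓ} (R : OrderedAbelianGroup c ℓ) (n d : ℕ)
    (M : Fin n → Fin d → OrderedAbelianGroup.Carrier R) (σ τ : BMat n d) →
    InPerm R M σ → τ ⪯ σ → InPerm R M τ
proposition5p1 R n d M σ τ ((rowsσ , colsσ) , σ-attains) τ⪯σ =
  (⪯-rowsUnique τ⪯σ rowsσ , ⪯-columnsUnique τ⪯σ colsσ) , τ-attains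
  where
  open OrderedAbelianGroup R using (_≤_)
  open Weights R using (+-cancelʳ-≤)

  τ-attains : ∀ τ′ → IsBijectionOnto R τ τ′ → weightVia R M τ τ′ ≤ weight R M τ
  τ-attains τ′ τ′-bij =
    +-cancelʳ-≤ surplus (subst₂ _≤_ weightVia-extend weight≡weight+surplus (σ-attains extend extend-bijection))
    where open Extension R M rowsσ colsσ τ⪯σ τ′-bij
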